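{- Let $A$ be a finite alphabet with $|A| = a \ge 3$ and let $n \in \{1,2,3\}$. There does not exist a nontrivial universal partial word for $A^n$.
   Context: A partial word over $A$ is a finite sequence of characters from $A \cup \{\diamond\}$, where $\diamond \notin A$ is a wild-card symbol; a word over $A$ contains no $\diamond$. $A^n$ denotes the set of words of length $n$ over $A$. For $x = x_1\cdots x_n \in A^n$ and a partial word $w = w_1\cdots w_N$, the position $i$ ($0 \le i \le N-n$) covers $x$ if $x_j = w_{i+j}$ for every $1\le j\le n$ with $w_{i+j}\in A$. A universal partial word for $A^n$ is a partial word $w$ such that every word in $A^n$ is covered by exactly one position of $w$; it is trivial if it equals $\diamond^n$ or contains no $\diamond$, and nontrivial otherwise. -}

module Defs where

open import Data.Nat using (ℕ; _+_; _≤_; suc; _<_)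
open import Data.Fin using (Fin)
open import Data.Maybe using (Maybe; just; nothing)
open import Data.List using (List; length; lookup; replicate)
open import Data.List.Relation.Unary.All using (All)
open import Data.List.Relation.Unary.Any using (Any)
open import Data.Vec as Vec using (Vec)
open import Data.Product using (Σ; _×_; _,_)
open import Data.Sum using (_⊎_)
open import Relation.Binary.PropositionalEquality using (_≡_; _≢_)
open import Relation.Nullary using (¬_)

-- A partial word over the alphabet A: a list of A ∪ {◇}, where ◇ is
-- represented by nothing and a letter c by just c.
PartialWord : Set → Set
PartialWord A = List (Maybe A)

◇ : {A : Set} → Maybe A
◇ = nothing

-- The entry of a partial word at position k (0-based); positions past the
-- end are read as ◇, but `covers` is only used for in-range positions.
entry : {A : Set} → PartialWord A → ℕ → Maybe A
entry Data.List.[] k = nothing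
entry (c Data.List.∷ w) 0 = c
entry (c Data.List.∷ w) (suc k) = entry w k

Compatible : {A : Set} → Maybe A → A → Set
Compatible e c = ∀ d → e ≡ just d → d ≡ c

Covers : {A : Set} {n : ℕ} → PartialWord A → ℕ → Vec A n → Set
Covers {n = n} w i x =
  (i + n ≤ length w) × ((j : Fin n) → Compatible (entry w (i + Data.Fin.toℕ j)) (Vec.lookup x j))

IsUniversal : {A : Set} → (n : ℕ) → PartialWord A → Set
IsUniversal n w =
  (x : Vec _ n) → Σ ℕ λ i → Covers w i x × (∀ i′ → Covers w i′ x → i′ ≡ i)

IsTrivial : {A : Set} → (n : ℕ) → PartialWord A → Set
IsTrivial n w = (w ≡ replicate n ◇) ⊎ All (λ e → e ≢ ◇) w

IsNontrivialUPW : {A : Set} → (n : ℕ) → PartialWord A → Set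
IsNontrivialUPW n w = IsUniversal n w × ¬ IsTrivial n w

-- Two distinct windows that fit a common word contradict uniqueness of covering. With a third
-- letter (third x y differs from x and y) one chooses words whose covering window is pinned next
-- to a hole and thereby exposes another hole. A universal word of length n is ◇ⁿ and there is
-- none of length n + 1, so a nontrivial one is longer and has a hole. For n = 1, 2 this already
-- yields two windows fitting a common word. For n = 3 a hole at p forces holes at p ± 3, so
-- every window contains a hole; wherever it lies in the window covering 000, a neighbouring
-- window fits a common word.
module Submission where

open import Defs
open import Data.Nat using (ℕ; zero; suc; _+_; _≤_; _<_; z≤n; s≤s; _≤?_)
open import Data.Nat.Properties
open import Data.Fin using (Fin; toℕ; zero; suc)
open import Data.Maybe using (Maybe; just; nothing; fromMaybe)
open import Data.List using ([]; _∷_; length; replicate)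
open import Data.List.Relation.Unary.All using (All; []; _∷_)
open import Data.Vec as Vec using (Vec; []; _∷_; lookup; tabulate)
open import Data.Vec.Properties using (lookup∘tabulate)
open import Data.Product using (Σ; _,_; _×_)
open import Data.Sum using (_⊎_; inj₁; inj₂)
open import Data.Unit using (⊤; tt)
open import Data.Empty using (⊥; ⊥-elim)
open import Function using (_∘_)
open import Relation.Nullary using (¬_; yes; no)
open import Relation.Binary.PropositionalEquality

module _ {A : Set} where

  compatible-◇ : ∀ {e : Maybe A} {c} → e ≡ ◇ → Compatible e c
  compatible-◇ refl _ ()

  compatible-fromMaybe : ∀ d (e : Maybe A) → Compatible e (fromMaybe d e)
  compatible-fromMaybe d (just c) .c refl = refl

  compatible⇒◇ : ∀ d {e : Maybe A} {c} → Compatible e c → fromMaybe d e ≢ c → e ≡ ◇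
  compatible⇒◇ d {nothing} _ _ = refl
  compatible⇒◇ d {just x} compatible x≢c = ⊥-elim (x≢c (compatible x refl))

  Hole : PartialWord A → Set
  Hole w = Σ ℕ λ p → p < length w × entry w p ≡ ◇

  hole-of-¬All≢◇ : ∀ w → ¬ All (_≢ ◇) w → Hole w
  hole-of-¬All≢◇ [] ¬all = ⊥-elim (¬all [])
  hole-of-¬All≢◇ (nothing ∷ w) _ = 0 , s≤s z≤n , refl
  hole-of-¬All≢◇ (just c ∷ w) ¬all with hole-of-¬All≢◇ w (¬all ∘ ((λ ()) ∷_))
  ... | p , p<N , hole = suc p , s≤s p<N , hole

  entries-◇⇒replicate : ∀ {n} (w : PartialWord A) → length w ≡ n →
                        (∀ (j : Fin n) → entry w (toℕ j) ≡ ◇) → w ≡ replicate n ◇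
  entries-◇⇒replicate [] refl _ = refl
  entries-◇⇒replicate (e ∷ w) refl holes = cong₂ _∷_ (holes zero) (entries-◇⇒replicate w refl (holes ∘ suc))

  -- Covers restated so that, for a concrete word and a window bound written n + i, both the
  -- bound and the letter conditions reduce by computation: windows are built and split by patterns.
  Fits : ∀ {n} → PartialWord A → ℕ → Vec A n → Set
  Fits w i [] = ⊤
  Fits w i (x ∷ xs) = Compatible (entry w i) x × Fits w (suc i) xs

  Window : ∀ {n} → PartialWord A → ℕ → Vec A n → Set
  Window {n} w i x = n + i ≤ length w × Fits w i x

  fits⇒compatible : ∀ {n w i} {x : Vec A n} → Fits w i x →
                    ∀ j → Compatible (entry w (i + toℕ j)) (lookup x j)
  fits⇒compatible {i = i} {_ ∷ _} (c , _) zero rewrite +-identityʳ i = c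
  fits⇒compatible {i = i} {_ ∷ _} (_ , f) (suc j) rewrite +-suc i (toℕ j) = fits⇒compatible f j

  compatible⇒fits : ∀ {n w i} {x : Vec A n} →
                    (∀ j → Compatible (entry w (i + toℕ j)) (lookup x j)) → Fits w i x
  compatible⇒fits {x = []} _ = tt
  compatible⇒fits {w = w} {i} {x ∷ xs} c = head , compatible⇒fits tail
    where
    head : Compatible (entry w i) x
    head = subst (λ m → Compatible (entry w m) x) (+-identityʳ i) (c zero)
    tail : ∀ j → Compatible (entry w (suc i + toℕ j)) (lookup xs j)
    tail j = subst (λ m → Compatible (entry w m) (lookup xs j)) (+-suc i (toℕ j)) (c (suc j))

  window⇒covers : ∀ {n w i} {x : Vec A n} → Window w i x → Covers w i x
  window⇒covers {n} {w} {i} (b , f) = subst (_≤ length w) (+-comm n i) b , fits⇒compatible f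

  covers⇒window : ∀ {n w i} {x : Vec A n} → Covers w i x → Window w i x
  covers⇒window {n} {w} {i} (b , c) = subst (_≤ length w) (+-comm i n) b , compatible⇒fits c

module Universal {A : Set} {n : ℕ} (w : PartialWord A) (universal : IsUniversal n w) where

  cover : (x : Vec A n) → Σ ℕ λ i → Window w i x
  cover x with universal x
  ... | i , covers , _ = i , covers⇒window covers

  window-unique : ∀ {i j} {x : Vec A n} → Window w i x → Window w j x → i ≡ j
  window-unique {x = x} wi wj with universal x
  ... | _ , _ , only = trans (only _ (window⇒covers wi)) (sym (only _ (window⇒covers wj)))

  length-≥ : A → n ≤ length w
  length-≥ a with cover (Vec.replicate n a)
  ... | _ , b , _ = m+n≤o⇒m≤o n b

module Letters {A : Set} (d : A) (w : PartialWord A) where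

  letterAt : ℕ → A
  letterAt k = fromMaybe d (entry w k)

  compatible-letterAt : ∀ k → Compatible (entry w k) (letterAt k)
  compatible-letterAt k = compatible-fromMaybe d (entry w k)

  window-letters : ∀ {n} i → n + i ≤ length w → Window w i (tabulate {n = n} λ j → letterAt (i + toℕ j))
  window-letters i b = b , compatible⇒fits λ j →
    subst (Compatible _) (sym (lookup∘tabulate _ j)) (compatible-letterAt (i + toℕ j))

  blank-window : ∀ {n} {x : Vec A n} i → n + i ≤ length w → (∀ j → entry w (i + toℕ j) ≡ ◇) → Window w i x
  blank-window i b blank = b , compatible⇒fits (compatible-◇ ∘ blank)

  window-avoiding⇒blank : ∀ {n} {i} (f : Fin n → A) → (∀ j → letterAt (i + toℕ j) ≢ f j) →
                          Window w i (tabulate f) → ∀ j → entry w (i + toℕ j) ≡ ◇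
  window-avoiding⇒blank f avoids (_ , fits) j =
    compatible⇒◇ d (subst (Compatible _) (lookup∘tabulate f j) (fits⇒compatible fits j)) (avoids j)

module Universal₁ {A : Set} (a : A) (w : PartialWord A) (universal : IsUniversal 1 w) where
  open Universal w universal
  open Letters a w

  no-hole : 2 ≤ length w → ¬ Hole w
  no-hole 2≤N (zero , p<N , hole) =
    0≢1+n (window-unique (p<N , compatible-◇ hole , tt) (2≤N , compatible-letterAt 1 , tt))
  no-hole 2≤N (suc q , p<N , hole) =
    0≢1+n (window-unique (<⇒≤ 2≤N , compatible-letterAt 0 , tt) (p<N , compatible-◇ hole , tt))

module _ {k : ℕ} where

  third : Fin (3 + k) → Fin (3 + k) → Fin (3 + k)
  third zero (suc zero) = suc (suc zero)
  third zero _ = suc zero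
  third (suc zero) zero = suc (suc zero)
  third (suc zero) (suc _) = zero
  third (suc (suc _)) zero = suc zero
  third (suc (suc _)) (suc _) = zero

  ≢-thirdˡ : ∀ x y → x ≢ third x y
  ≢-thirdˡ zero zero ()
  ≢-thirdˡ zero (suc zero) ()
  ≢-thirdˡ zero (suc (suc _)) ()
  ≢-thirdˡ (suc zero) zero ()
  ≢-thirdˡ (suc zero) (suc _) ()
  ≢-thirdˡ (suc (suc _)) zero ()
  ≢-thirdˡ (suc (suc _)) (suc _) ()

  ≢-thirdʳ : ∀ x y → y ≢ third x y
  ≢-thirdʳ zero zero ()
  ≢-thirdʳ zero (suc zero) ()
  ≢-thirdʳ zero (suc (suc _)) ()
  ≢-thirdʳ (suc zero) zero ()
  ≢-thirdʳ (suc zero) (suc _) ()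
  ≢-thirdʳ (suc (suc _)) zero ()
  ≢-thirdʳ (suc (suc _)) (suc _) ()

  compatible-third⇒◇ˡ : ∀ {e y} → Compatible e (third (fromMaybe zero e) y) → e ≡ ◇
  compatible-third⇒◇ˡ {e} {y} c = compatible⇒◇ zero c (≢-thirdˡ (fromMaybe zero e) y)

  compatible-third⇒◇ʳ : ∀ {e x} → Compatible e (third x (fromMaybe zero e)) → e ≡ ◇
  compatible-third⇒◇ʳ {e} {x} c = compatible⇒◇ zero c (≢-thirdʳ x (fromMaybe zero e))

  module _ {n} (w : PartialWord (Fin (3 + k))) (universal : IsUniversal n w) where
    open Universal w universal
    open Letters zero w

    universal⇒length≡n⇒◇ⁿ : length w ≡ n → w ≡ replicate n ◇
    universal⇒length≡n⇒◇ⁿ N≡n with cover (tabulate λ j → third (letterAt (toℕ j)) (letterAt (toℕ j)))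
    ... | i , win@(b , _) with n≤0⇒n≡0 (+-cancelˡ-≤ n i 0 (subst (n + i ≤_) (trans N≡n (sym (+-identityʳ n))) b))
    ... | refl = entries-◇⇒replicate w N≡n (window-avoiding⇒blank _ (λ j → ≢-thirdˡ _ _) win)

    universal∧nontrivial⇒n<length : ¬ IsTrivial n w → n < length w
    universal∧nontrivial⇒n<length nontrivial with m≤n⇒m<n∨m≡n (length-≥ zero)
    ... | inj₁ n<N = n<N
    ... | inj₂ n≡N = ⊥-elim (nontrivial (inj₁ (universal⇒length≡n⇒◇ⁿ (sym n≡N))))

    universal⇒length≢1+n : length w ≢ suc n
    universal⇒length≢1+n N≡1+n = two-windows (cover x)
      where
      x : Vec (Fin (3 + k)) n
      x = tabulate λ j → third (letterAt (toℕ j)) (letterAt (suc (toℕ j)))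
      window₁-valid : n + 1 ≤ length w
      window₁-valid = ≤-reflexive (trans (+-comm n 1) (sym N≡1+n))
      window₀-valid : n + 0 ≤ length w
      window₀-valid = ≤-trans (+-monoʳ-≤ n z≤n) window₁-valid
      two-windows : Σ ℕ (λ i → Window w i x) → ⊥
      two-windows (zero , win) =
        0≢1+n (window-unique (blank-window 0 window₀-valid (window-avoiding⇒blank _ (λ j → ≢-thirdˡ _ _) win))
                             (window-letters 1 window₁-valid))
      two-windows (suc zero , win) =
        0≢1+n (window-unique (window-letters 0 window₀-valid)
                             (blank-window 1 window₁-valid (window-avoiding⇒blank _ (λ j → ≢-thirdʳ _ _) win)))
      two-windows (suc (suc i) , b , _) =
        m+1+n≰m n (≤-pred (subst (_≤ suc n) (+-suc n (suc i)) (subst (n + suc (suc i) ≤_) N≡1+n b)))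

  module Universal₂ (w : PartialWord (Fin (3 + k))) (universal : IsUniversal 2 w) where
    open Universal w universal
    open Letters zero w

    private
      N : ℕ
      N = length w
      E : ℕ → Maybe (Fin (3 + k))
      E = entry w
      L : ℕ → Fin (3 + k)
      L = letterAt
      fit : ∀ m → Compatible (E m) (L m)
      fit = compatible-letterAt

    no-hole-at-start : 3 ≤ N → E 0 ≡ ◇ → ⊥
    no-hole-at-start 3≤N hole with cover (L 1 ∷ third (L 1) (L 2) ∷ [])
    ... | zero , (_ , _ , c1 , _) =
      0≢1+n (window-unique (<⇒≤ 3≤N , compatible-◇ hole , compatible-◇ (compatible-third⇒◇ˡ c1) , tt)
                           (3≤N , fit 1 , fit 2 , tt))
    ... | suc zero , (_ , _ , c2 , _) =
      0≢1+n (window-unique (<⇒≤ 3≤N , compatible-◇ hole , fit 1 , tt)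
                           (3≤N , fit 1 , compatible-◇ (compatible-third⇒◇ʳ c2) , tt))
    ... | suc (suc j) , (b , c , _) =
      0≢1+n (window-unique (<⇒≤ 3≤N , compatible-◇ hole , fit 1 , tt)
                           (<⇒≤ b , fit (suc j) , c , tt))

    no-hole-inside : ∀ q → 2 + suc q ≤ N → E (suc q) ≡ ◇ → ⊥
    no-hole-inside q inside hole =
      m≢1+n+m q {0} (window-unique (<⇒≤ inside , fit q , compatible-◇ hole , tt)
                                   (inside , compatible-◇ hole , fit (2 + q) , tt))

    no-hole-at-end : ∀ r → 3 + r ≡ N → E (2 + r) ≡ ◇ → ⊥
    no-hole-at-end r last hole with cover (third (L (1 + r)) (L r) ∷ L (1 + r) ∷ [])
    ... | j , b , c0 , c1 , _ with 2 + suc j ≤? N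
    ...   | yes b′ with window-unique (b′ , c1 , fit (2 + j) , tt) (≤-reflexive last , fit (1 + r) , compatible-◇ hole , tt)
    ...     | refl =
      m≢1+n+m r {0} (window-unique (<⇒≤ (≤-reflexive last) , compatible-◇ (compatible-third⇒◇ʳ c0) , fit (1 + r) , tt)
                                   (≤-reflexive last , fit (1 + r) , compatible-◇ hole , tt))
    no-hole-at-end r last hole | j , b , c0 , c1 , _ | no b′
      with +-cancelˡ-≡ 2 j (1 + r) (trans (≤-antisym b (≮⇒≥ b′)) (sym last))
    ... | refl =
      1+n≢n (window-unique (b , compatible-◇ (compatible-third⇒◇ˡ c0) , compatible-◇ hole , tt)
                           (<⇒≤ b , fit r , fit (1 + r) , tt))

    no-hole : 3 ≤ N → ¬ Hole w
    no-hole 3≤N (zero , _ , hole) = no-hole-at-start 3≤N hole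
    no-hole 3≤N (suc q , p<N , hole) with 2 + suc q ≤? N
    ... | yes inside = no-hole-inside q inside hole
    no-hole 3≤N (suc zero , _ , _) | no outside = outside 3≤N
    no-hole 3≤N (suc (suc r) , p<N , hole) | no outside = no-hole-at-end r (≤-antisym p<N (≮⇒≥ outside)) hole

  module Universal₃ (w : PartialWord (Fin (3 + k))) (universal : IsUniversal 3 w) where
    open Universal w universal
    open Letters zero w

    private
      N : ℕ
      N = length w
      E : ℕ → Maybe (Fin (3 + k))
      E = entry w
      L : ℕ → Fin (3 + k)
      L = letterAt
      fit : ∀ m → Compatible (E m) (L m)
      fit = compatible-letterAt

    after-hole : ∀ {p j y} → E p ≡ ◇ → 3 + p ≤ N →
                 Window w (suc j) (L (1 + p) ∷ L (2 + p) ∷ y ∷ []) → j ≡ p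
    after-hole {p} {j} hole valid (b , c1 , c2 , _ , _) =
      window-unique (<⇒≤ b , fit j , c1 , c2 , tt) (valid , compatible-◇ hole , fit (1 + p) , fit (2 + p) , tt)

    before-hole : ∀ {p j y} → E (2 + p) ≡ ◇ → 3 + p ≤ N →
                  Window w j (y ∷ L p ∷ L (1 + p) ∷ []) → 3 + suc j ≤ N → suc j ≡ p
    before-hole {p} {j} hole valid (_ , _ , c1 , c2 , _) valid′ =
      window-unique (valid′ , c1 , c2 , fit (3 + j) , tt) (valid , fit p , fit (1 + p) , compatible-◇ hole , tt)

    -- The word is covered by window 0 or, by after-hole, window 1 + p; its last letter then makes
    -- E 2 or E (3 + p) a hole, and a hole at 2 would let windows 0 and 1 + p share a word.
    hole-step : ∀ p → 3 + p < N → E p ≡ ◇ → E (3 + p) ≡ ◇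
    hole-step p lt hole with cover (L (1 + p) ∷ L (2 + p) ∷ third (L 2) (L (3 + p)) ∷ [])
    ... | zero , (b , c0 , c1 , c2 , _) =
      ⊥-elim (0≢1+n (window-unique (b , c0 , c1 , compatible-◇ (compatible-third⇒◇ˡ c2) , tt)
                                   (lt , fit (1 + p) , fit (2 + p) , fit (3 + p) , tt)))
    ... | suc j , win@(_ , _ , _ , c , _) with after-hole hole (<⇒≤ lt) win
    ...   | refl = compatible-third⇒◇ʳ c

    -- Mirror image of hole-step, with the last window M in place of window 0.
    hole-step-back : ∀ r → 3 + r < N → E (3 + r) ≡ ◇ → E r ≡ ◇
    hole-step-back r lt hole with m≤n⇒∃[o]m+o≡n (≤-trans (m≤m+n 3 r) (<⇒≤ lt))
    ... | M , last with cover (third (L r) (L M) ∷ L (1 + r) ∷ L (2 + r) ∷ [])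
    ...   | j , win@(b , c0 , c1 , c2 , _) with 3 + suc j ≤? N
    ...     | yes b′ with before-hole {suc r} hole lt win b′
    ...       | refl = compatible-third⇒◇ˡ c0
    hole-step-back r lt hole | M , last | j , (b , c0 , c1 , c2 , _) | no b′
      with +-cancelˡ-≡ 3 j M (trans (≤-antisym b (≮⇒≥ b′)) (sym last))
    ... | refl = ⊥-elim (b′ (subst (λ i → 3 + suc i ≤ N) (sym j≡r) lt))
      where
      j≡r : j ≡ r
      j≡r = window-unique (b , compatible-◇ (compatible-third⇒◇ʳ c0) , c1 , c2 , tt)
                          (<⇒≤ lt , fit r , fit (1 + r) , fit (2 + r) , tt)

    Holed : ℕ → Set
    Holed i = E i ≡ ◇ ⊎ E (1 + i) ≡ ◇ ⊎ E (2 + i) ≡ ◇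

    holed-suc : ∀ {i} → 3 + suc i ≤ N → Holed i → Holed (suc i)
    holed-suc valid (inj₁ hole) = inj₂ (inj₂ (hole-step _ valid hole))
    holed-suc _ (inj₂ (inj₁ hole)) = inj₁ hole
    holed-suc _ (inj₂ (inj₂ hole)) = inj₂ (inj₁ hole)

    first-window-holed : ∀ p → p < N → E p ≡ ◇ → Holed 0
    first-window-holed 0 _ hole = inj₁ hole
    first-window-holed 1 _ hole = inj₂ (inj₁ hole)
    first-window-holed 2 _ hole = inj₂ (inj₂ hole)
    first-window-holed (suc (suc (suc r))) lt hole =
      first-window-holed r (≤-trans (s≤s (m≤n+m r 3)) lt) (hole-step-back r lt hole)

    every-window-holed : Holed 0 → ∀ i → 3 + i ≤ N → Holed i
    every-window-holed holed zero _ = holed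
    every-window-holed holed (suc i) valid = holed-suc valid (every-window-holed holed i (<⇒≤ valid))

    zeros : Vec (Fin (3 + k)) 3
    zeros = Vec.replicate 3 zero

    -- Holes at distance 3 from the hole of the window covering zeros (hole-step, hole-step-back)
    -- provide, at either end of w, a second window fitting a common word.
    zeros-window-no-hole-at-0 : 5 ≤ N → ∀ i → Window w i zeros → E i ≡ ◇ → ⊥
    zeros-window-no-hole-at-0 5≤N zero (b , _ , c1 , c2 , _) hole =
      0≢1+n (window-unique (b , compatible-◇ hole , c1 , c2 , tt)
                           (<⇒≤ 5≤N , c1 , c2 , compatible-◇ (hole-step 0 (<⇒≤ 5≤N) hole) , tt))
    zeros-window-no-hole-at-0 _ (suc m) (b , _ , c1 , c2 , _) hole =
      m≢1+n+m m {0} (window-unique (<⇒≤ b , fit m , compatible-◇ hole , c1 , tt) (b , compatible-◇ hole , c1 , c2 , tt))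

    zeros-window-no-hole-at-1 : 5 ≤ N → ∀ i → Window w i zeros → E (1 + i) ≡ ◇ → ⊥
    zeros-window-no-hole-at-1 5≤N zero (b , c0 , _ , c2 , _) hole =
      0≢1+n (window-unique (b , c0 , compatible-◇ hole , c2 , tt)
                           (5≤N , c2 , fit 3 , compatible-◇ (hole-step 1 5≤N hole) , tt))
    zeros-window-no-hole-at-1 5≤N (suc m) (b , c0 , _ , c2 , _) hole with 3 + suc (suc m) ≤? N
    ... | yes b′ =
      m≢1+n+m m {1} (window-unique (<⇒≤ b , fit m , c0 , compatible-◇ hole , tt)
                                   (b′ , compatible-◇ hole , c2 , fit (3 + suc m) , tt))
    zeros-window-no-hole-at-1 5≤N (suc zero) _ _ | no b′ = b′ 5≤N
    zeros-window-no-hole-at-1 5≤N (suc (suc m)) (b , c0 , _ , c2 , _) hole | no _ =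
      m≢1+n+m m {1} (window-unique (<⇒≤ (<⇒≤ b) , compatible-◇ (hole-step-back m (<⇒≤ b) hole) , fit (1 + m) , c0 , tt)
                                   (b , c0 , compatible-◇ hole , c2 , tt))

    zeros-window-no-hole-at-2 : 5 ≤ N → ∀ i → Window w i zeros → E (2 + i) ≡ ◇ → ⊥
    zeros-window-no-hole-at-2 5≤N i (b , c0 , c1 , _ , _) hole with 3 + suc i ≤? N
    ... | yes b′ =
      m≢1+n+m i {0} (window-unique (b , c0 , c1 , compatible-◇ hole , tt)
                                   (b′ , c1 , compatible-◇ hole , fit (3 + i) , tt))
    zeros-window-no-hole-at-2 5≤N zero _ _ | no b′ = b′ (<⇒≤ 5≤N)
    zeros-window-no-hole-at-2 5≤N (suc m) (b , c0 , c1 , _ , _) hole | no _ =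
      m≢1+n+m m {0} (window-unique (<⇒≤ b , compatible-◇ (hole-step-back m b hole) , c0 , c1 , tt)
                                   (b , c0 , c1 , compatible-◇ hole , tt))

    no-hole : 5 ≤ N → ¬ Hole w
    no-hole 5≤N (p , p<N , hole) with cover zeros
    ... | i , win@(b , _) with every-window-holed (first-window-holed p p<N hole) i b
    ...   | inj₁ h = zeros-window-no-hole-at-0 5≤N i win h
    ...   | inj₂ (inj₁ h) = zeros-window-no-hole-at-1 5≤N i win h
    ...   | inj₂ (inj₂ h) = zeros-window-no-hole-at-2 5≤N i win h

proposition5p1 : (a n : ℕ) → 3 ≤ a → 1 ≤ n → n ≤ 3 →
    ¬ Σ (PartialWord (Fin a)) (λ w → IsNontrivialUPW n w)
proposition5p1 _ 0 _ () _ _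
proposition5p1 _ 1 (s≤s (s≤s (s≤s _))) _ _ (w , universal , nontrivial) =
  Universal₁.no-hole zero w universal (universal∧nontrivial⇒n<length w universal nontrivial)
    (hole-of-¬All≢◇ w (nontrivial ∘ inj₂))
proposition5p1 _ 2 (s≤s (s≤s (s≤s _))) _ _ (w , universal , nontrivial) =
  Universal₂.no-hole w universal (universal∧nontrivial⇒n<length w universal nontrivial)
    (hole-of-¬All≢◇ w (nontrivial ∘ inj₂))
proposition5p1 _ 3 (s≤s (s≤s (s≤s _))) _ _ (w , universal , nontrivial)
  with m≤n⇒m<n∨m≡n (universal∧nontrivial⇒n<length w universal nontrivial)
... | inj₁ 5≤N = Universal₃.no-hole w universal 5≤N (hole-of-¬All≢◇ w (nontrivial ∘ inj₂))
... | inj₂ 4≡N = universal⇒length≢1+n w universal (sym 4≡N)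
proposition5p1 _ (suc (suc (suc (suc _)))) _ _ (s≤s (s≤s (s≤s ()))) _
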